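{- $c(2,1)\leq 3$, $c(3,-1)>3$, and $c(2,2)>3$.
   Context: A finite digraph $D=(V,A)$ is covered by $k$ cuts if there are $U_1,\dots,U_k\subseteq V$ such that every arc $uv\in A$ has some $a$ with $u\in U_a$, $v\notin U_a$; equivalently, there is a labeling $C:V\to\mathcal{P}(\{1,\dots,k\})$ with $C(u)\not\subseteq C(v)$ for every arc $uv$. For integers $\Delta^-,\Delta^+\geq -1$, $\mathcal{D}(\Delta^-,\Delta^+)$ is the class of all finite acyclic digraphs in which every vertex has indegree at most $\Delta^-$ or outdegree at most $\Delta^+$ (so $\mathcal{D}(\Delta^-,-1)$ is the class of acyclic digraphs of maximum indegree at most $\Delta^-$), and $c(\Delta^-,\Delta^+)$ is the smallest $k$ such that every digraph in $\mathcal{D}(\Delta^-,\Delta^+)$ is covered by $k$ cuts. -}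

module Defs where

open import Data.Nat using (ℕ; suc)
open import Data.Integer using (ℤ; +_; _≤_)
open import Data.Bool using (Bool; true; false)
open import Data.Fin using (Fin)
open import Data.List using (List; length; filter; allFin)
open import Data.Product using (Σ; ∃; _×_)
open import Data.Sum using (_⊎_)
open import Relation.Binary.PropositionalEquality using (_≡_)
open import Relation.Nullary using (¬_)
open import Data.Bool.Properties using (T?)

record Digraph : Set where
  field
    n   : ℕ
    arc : Fin n → Fin n → Bool
open Digraph public

data Walk (D : Digraph) : Fin (n D) → Fin (n D) → Set where
  one  : ∀ {u v} → arc D u v ≡ true → Walk D u v
  step : ∀ {u v w} → arc D u v ≡ true → Walk D v w → Walk D u w

Acyclic : Digraph → Set
Acyclic D = ∀ v → ¬ Walk D v v

indeg : (D : Digraph) → Fin (n D) → ℕ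
indeg D v = length (filter (λ u → T? (arc D u v)) (allFin (n D)))

outdeg : (D : Digraph) → Fin (n D) → ℕ
outdeg D u = length (filter (λ v → T? (arc D u v)) (allFin (n D)))

-- The class 𝒟(Δ⁻,Δ⁺), with Δ⁻, Δ⁺ ∈ ℤ (intended ≥ -1).
InClass : ℤ → ℤ → Digraph → Set
InClass Δ⁻ Δ⁺ D = Acyclic D × (∀ v → (+ indeg D v ≤ Δ⁻) ⊎ (+ outdeg D v ≤ Δ⁺))

CoveredBy : ℕ → Digraph → Set
CoveredBy k D = Σ (Fin k → Fin (n D) → Bool) λ U →
  ∀ u v → arc D u v ≡ true → ∃ λ a → U a u ≡ true × U a v ≡ false

c≤ : ℤ → ℤ → ℕ → Set
c≤ Δ⁻ Δ⁺ k = ∀ D → InClass Δ⁻ Δ⁺ D → CoveredBy k D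

-- Upper bound: split the vertices into inner ones, of indegree at most 2, and outer ones,
-- of outdegree at most 1.  For a colouring c : V → {1,2,3}, label inner vertices by
-- {1,2,3} ∖ {c v} and outer ones by {c v}; this is a cover as soon as c u ≠ c v on
-- inner→inner and outer→outer arcs and c u = c v on outer→inner arcs.  Such a c comes from
-- two recursions along a topological order: first colour every vertex greedily away from
-- its at most two in-neighbours; then, backwards, keep that colour on inner vertices and give
-- each outer vertex the colour of its out-neighbour if that one is inner, and a different
-- colour if it is outer.
--
-- Lower bounds: the cube of the directed path on 11 vertices, which lies in 𝒟(3,-1), and an
-- 11-vertex digraph of 𝒟(2,2) have no labelling by subsets of {1,2,3}.  This is checked by
-- computing the labellings of ever larger initial segments of a topological order.

module Submission where

open import Defs
open import Data.Bool using (Bool; true; false; not; _xor_)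
open import Data.Bool.Properties using (T-≡; T?) renaming (_≟_ to _≟ᵇ_)
open import Data.Empty using (⊥-elim)
open import Data.Fin using (Fin; zero; suc; toℕ; #_)
open import Data.Fin.Properties using (_≟_; any?; all?; pigeonhole; injective⇒≤; toℕ≤pred[n])
open import Data.Integer using (+_; -[1+_])
import Data.Integer as ℤ
import Data.Integer.Properties as ℤ
open import Data.List
  using (List; []; _∷_; [_]; length; lookup; map; filter; allFin; take; head
        ; concatMap; cartesianProductWith)
open import Data.List.Membership.Propositional using (_∈_; _∉_)
open import Data.List.Membership.Propositional.Properties
  using (∈-filter⁺; ∈-filter⁻; ∈-allFin; ∈-map⁺; ∈-concatMap⁺; ∈-cartesianProductWith⁺)
open import Data.List.Properties using (length-map; map-cong-local)
open import Data.List.Relation.Unary.All as All using (All)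
open import Data.List.Relation.Unary.Any as Any using (here; there)
open import Data.List.Relation.Unary.Any.Properties using (lookup-index; ¬Any[])
open import Data.Maybe using (fromMaybe)
open import Data.Nat using (ℕ; zero; suc; _≤_; _<_; z≤n; s≤s; z<s)
open import Data.Nat.Properties using (≤-trans; <-trans; <-irrefl; n<1+n; <⇒≤; m≤n⇒m<n∨m≡n; n≮n)
open import Data.Product using (Σ; ∃; _×_; _,_; proj₁; proj₂)
open import Data.Sum as Sum using (_⊎_; inj₁; inj₂)
open import Data.Unit using (⊤; tt)
open import Data.Vec as Vec using (Vec; []; _∷_; tabulate)
open import Data.Vec.Properties using (lookup∘tabulate)
open import Function using (_∘_; const)
open import Function.Bundles using (Equivalence)
open import Relation.Binary.PropositionalEquality
  using (_≡_; _≢_; _≗_; refl; sym; trans; cong; subst; module ≡-Reasoning)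
open import Relation.Nullary using (¬_; Dec; yes; no; does)
open import Relation.Nullary.Decidable
  using (True; toWitness; dec-true; dec-false; decidable-stable; ¬?; _×-dec_; _⊎-dec_)

private
  variable
    A : Set
    k m : ℕ
    D : Digraph

inNeighbours : (D : Digraph) → Fin (n D) → List (Fin (n D))
inNeighbours D v = filter (λ u → T? (arc D u v)) (allFin (n D))

reverse : Digraph → Digraph
reverse D = record { n = n D ; arc = λ u v → arc D v u }

outNeighbours : (D : Digraph) → Fin (n D) → List (Fin (n D))
outNeighbours D = inNeighbours (reverse D)

∈-inNeighbours⁺ : ∀ {u v} → arc D u v ≡ true → u ∈ inNeighbours D v
∈-inNeighbours⁺ {D} {u} {v} uv =
  ∈-filter⁺ (λ u → T? (arc D u v)) (∈-allFin u) (Equivalence.from T-≡ uv)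

∈-inNeighbours⁻ : ∀ {u v} → u ∈ inNeighbours D v → arc D u v ≡ true
∈-inNeighbours⁻ {D} {u} {v} u∈ =
  Equivalence.to T-≡ (proj₂ (∈-filter⁻ (λ u → T? (arc D u v)) {xs = allFin (n D)} u∈))

_▷_ : ∀ {u v w} → Walk D u v → arc D v w ≡ true → Walk D u w
one uv    ▷ vw = step uv (one vw)
step uv p ▷ vw = step uv (p ▷ vw)

reverseWalk : ∀ {u v} → Walk (reverse D) u v → Walk D v u
reverseWalk (one vu)    = one vu
reverseWalk (step vu p) = reverseWalk p ▷ vu

reverse-acyclic : Acyclic D → Acyclic (reverse D)
reverse-acyclic acyclic v = acyclic v ∘ reverseWalk

IsPath : (D : Digraph) → ℕ → (ℕ → Fin (n D)) → Set
IsPath D k p = ∀ i → i < k → arc D (p i) (p (suc i)) ≡ true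

path-segment : ∀ {p} → IsPath D k p → ∀ {i j} → i < j → j ≤ k → Walk D (p i) (p j)
path-segment path {i} {suc j} (s≤s i≤j) 1+j≤k with m≤n⇒m<n∨m≡n i≤j
... | inj₁ i<j  = path-segment path i<j (<⇒≤ 1+j≤k) ▷ path j 1+j≤k
... | inj₂ refl = one (path i 1+j≤k)

acyclic⇒¬IsPath-n : Acyclic D → ∀ p → ¬ IsPath D (n D) p
acyclic⇒¬IsPath-n {D} acyclic p path
  with pigeonhole (n<1+n (n D)) (p ∘ toℕ)
... | i , j , i<j , pi≡pj =
  acyclic (p (toℕ i))
    (subst (Walk D (p (toℕ i))) (sym pi≡pj) (path-segment path i<j (toℕ≤pred[n] j)))

InLocal : (D : Digraph) → ((Fin (n D) → A) → Fin (n D) → A) → Set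
InLocal D F = ∀ {c c′} v → All (λ u → c u ≡ c′ u) (inNeighbours D v) → F c v ≡ F c′ v

-- Iterating F from c₀, the k-th and (k+1)-th iterates agree at every vertex
-- that starts no path of length k in reverse D; there is no path of length n.
local-fixpoint : ∀ {F : (Fin (n D) → A) → Fin (n D) → A} →
                 Acyclic D → InLocal D F → (Fin (n D) → A) → Σ (Fin (n D) → A) λ c → F c ≗ c
local-fixpoint {D = D} {A = A} {F = F} acyclic local c₀ =
  iterate (n D) , λ v → sym (stable (n D) v (λ p _ → acyclic⇒¬IsPath-n (reverse-acyclic acyclic) p))
  where
  iterate : ℕ → Fin (n D) → A
  iterate zero    = c₀
  iterate (suc k) = F (iterate k)

  stable : ∀ k v → (∀ p → p 0 ≡ v → ¬ IsPath (reverse D) k p) →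
           iterate k v ≡ iterate (suc k) v
  stable zero    v short = ⊥-elim (short (const v) refl (λ _ ()))
  stable (suc k) v short = local v (All.tabulate λ {u} u∈ → stable k u λ p p0≡u path →
    short (λ { zero → v ; (suc i) → p i }) refl λ
      { zero    _         → subst (λ w → arc D w v ≡ true) (sym p0≡u) (∈-inNeighbours⁻ {D} u∈)
      ; (suc i) (s≤s i<k) → path i i<k })

∀∈⇒≤length : {xs : List (Fin m)} → (∀ a → a ∈ xs) → m ≤ length xs
∀∈⇒≤length {xs = xs} all∈ = injective⇒≤ λ {a} {b} index≡ →
  trans (lookup-index (all∈ a)) (trans (cong (lookup xs) index≡) (sym (lookup-index (all∈ b))))

pick : List (Fin (suc m)) → Fin (suc m)
pick xs with any? (λ a → ¬? (Any.any? (a ≟_) xs))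
... | yes (a , _) = a
... | no _        = zero

pick-∉ : (xs : List (Fin (suc m))) → length xs ≤ m → pick xs ∉ xs
pick-∉ {m} xs short with any? (λ a → ¬? (Any.any? (a ≟_) xs))
... | yes (_ , a∉) = a∉
... | no ∄a∉       = ⊥-elim (n≮n m (≤-trans (∀∈⇒≤length all∈) short))
  where
  all∈ : ∀ a → a ∈ xs
  all∈ a = decidable-stable (Any.any? (a ≟_) xs) (λ a∉ → ∄a∉ (a , a∉))

other : Fin 3 → Fin 3
other x = pick [ x ]

other-≢ : ∀ x → other x ≢ x
other-≢ x eq = pick-∉ [ x ] (s≤s z≤n) (here eq)

Fits : Bool → Bool → Fin 3 → Fin 3 → Set
Fits true  true  x y = x ≢ y
Fits true  false _ _ = ⊤
Fits false true  x y = x ≡ y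
Fits false false x y = x ≢ y

-- Cut a contains a vertex of side s and colour x iff s xor (a = x), with s = true for inner.
fits⇒separated : ∀ s t {x y} → Fits s t x y →
                 ∃ λ a → s xor does (a ≟ x) ≡ true × t xor does (a ≟ y) ≡ false
fits⇒separated true true {x} {y} x≢y =
  y , cong not (dec-false (y ≟ x) (x≢y ∘ sym)) , cong not (dec-true (y ≟ y) refl)
fits⇒separated true false {x} {y} tt =
  a , cong not (dec-false (a ≟ x) (pick-∉ xy (s≤s (s≤s z≤n)) ∘ here))
    , dec-false (a ≟ y) (pick-∉ xy (s≤s (s≤s z≤n)) ∘ there ∘ here)
  where
  xy : List (Fin 3)
  xy = x ∷ y ∷ []
  a : Fin 3
  a = pick xy
fits⇒separated false true {x} refl = x , dec-true (x ≟ x) refl , cong not (dec-true (x ≟ x) refl)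
fits⇒separated false false {x} {y} x≢y = x , dec-true (x ≟ x) refl , dec-false (x ≟ y) x≢y

fitting⇒covered : ∀ (D : Digraph) (inner : Fin (n D) → Bool) (c : Fin (n D) → Fin 3) →
                  (∀ u v → arc D u v ≡ true → Fits (inner u) (inner v) (c u) (c v)) →
                  CoveredBy 3 D
fitting⇒covered D inner c fits =
  (λ a v → inner v xor does (a ≟ c v)) , λ u v uv → fits⇒separated (inner u) (inner v) (fits u v uv)

∈-sole : ∀ {xs : List A} {x} → length xs ≤ 1 → x ∈ xs → xs ≡ [ x ]
∈-sole {xs = _ ∷ []}    _        (here refl) = refl
∈-sole {xs = _ ∷ _ ∷ _} (s≤s ()) _

module FittingColouring (D : Digraph) (acyclic : Acyclic D)
                        (side : ∀ v → indeg D v ≤ 2 ⊎ outdeg D v ≤ 1) where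

  private
    V : Set
    V = Fin (n D)

    Side : V → Set
    Side v = indeg D v ≤ 2 ⊎ outdeg D v ≤ 1

  inner : V → Bool
  inner v = Sum.[ const true , const false ]′ (side v)

  greedy : (V → Fin 3) → V → Fin 3
  greedy c v = pick (map c (inNeighbours D v))

  greedy-local : InLocal D greedy
  greedy-local v = cong pick ∘ map-cong-local

  greedy-fixpoint : Σ (V → Fin 3) λ c → greedy c ≗ c
  greedy-fixpoint = local-fixpoint acyclic greedy-local (const zero)

  c₁ : V → Fin 3
  c₁ = proj₁ greedy-fixpoint

  c₁-proper : ∀ {u v} → arc D u v ≡ true → indeg D v ≤ 2 → c₁ u ≢ c₁ v
  c₁-proper {u} {v} uv indeg≤2 c₁u≡c₁v =
    pick-∉ (map c₁ ins) (subst (_≤ 2) (sym (length-map c₁ ins)) indeg≤2)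
      (subst (_∈ map c₁ ins) (trans c₁u≡c₁v (sym (proj₂ greedy-fixpoint v)))
        (∈-map⁺ c₁ (∈-inNeighbours⁺ {D} uv)))
    where
    ins : List V
    ins = inNeighbours D v

  follow : ∀ {w} → Side w → Fin 3 → Fin 3
  follow (inj₁ _) x = x
  follow (inj₂ _) x = other x

  propagateAt : (V → Fin 3) → (v : V) → Side v → Fin 3
  propagateAt c v (inj₁ _) = c₁ v
  propagateAt c v (inj₂ _) =
    fromMaybe zero (head (map (λ w → follow (side w) (c w)) (outNeighbours D v)))

  propagate : (V → Fin 3) → V → Fin 3
  propagate c v = propagateAt c v (side v)

  propagate-local : InLocal (reverse D) propagate
  propagate-local v agree with side v
  ... | inj₁ _ = refl
  ... | inj₂ _ = cong (fromMaybe zero ∘ head) (map-cong-local (All.map (cong (follow (side _))) agree))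

  propagate-fixpoint : Σ (V → Fin 3) λ c → propagate c ≗ c
  propagate-fixpoint = local-fixpoint (reverse-acyclic acyclic) propagate-local (const zero)

  c₂ : V → Fin 3
  c₂ = proj₁ propagate-fixpoint

  c₂-inner : ∀ {v p} → side v ≡ inj₁ p → c₂ v ≡ c₁ v
  c₂-inner {v} eq = trans (sym (proj₂ propagate-fixpoint v)) (cong (propagateAt c₂ v) eq)

  c₂-outer : ∀ {u v p s} → side u ≡ inj₂ p → arc D u v ≡ true → side v ≡ s →
             c₂ u ≡ follow s (c₂ v)
  c₂-outer {u} {v} {p} eq uv refl = begin
    c₂ u                                              ≡⟨ sym (proj₂ propagate-fixpoint u) ⟩
    propagateAt c₂ u (side u)                         ≡⟨ cong (propagateAt c₂ u) eq ⟩
    fromMaybe zero (head (map f (outNeighbours D u))) ≡⟨ cong (fromMaybe zero ∘ head ∘ map f)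
                                                              outs≡[v] ⟩
    f v                                               ∎
    where
    open ≡-Reasoning
    f : V → Fin 3
    f w = follow (side w) (c₂ w)
    outs≡[v] : outNeighbours D u ≡ [ v ]
    outs≡[v] = ∈-sole p (∈-inNeighbours⁺ {reverse D} uv)

  c₂-fits : ∀ u v → arc D u v ≡ true → Fits (inner u) (inner v) (c₂ u) (c₂ v)
  c₂-fits u v uv with side u in eu | side v in ev
  ... | inj₁ _ | inj₁ indeg≤2 =
    λ eq → c₁-proper uv indeg≤2 (trans (sym (c₂-inner eu)) (trans eq (c₂-inner ev)))
  ... | inj₁ _ | inj₂ _       = tt
  ... | inj₂ _ | inj₁ _       = c₂-outer eu uv ev
  ... | inj₂ _ | inj₂ _       = λ eq → other-≢ (c₂ v) (trans (sym (c₂-outer eu uv ev)) eq)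

c[2,1]≤3 : c≤ (+ 2) (+ 1) 3
c[2,1]≤3 D (acyclic , degrees) = fitting⇒covered D inner c₂ c₂-fits
  where open FittingColouring D acyclic (Sum.map ℤ.drop‿+≤+ ℤ.drop‿+≤+ ∘ degrees)

-- ins ◁ G adds to G a new vertex zero with in-neighbours ins (in G's numbering) and shifts
-- the old vertices by suc: vertices are numbered from the most recently added one, and arcs
-- go from larger to smaller numbers.
infixr 5 _◁_
data Dag : ℕ → Set where
  []  : Dag 0
  _◁_ : List (Fin k) → Dag k → Dag (suc k)

dagArc : Dag m → Fin m → Fin m → Bool
dagArc (ins ◁ G) (suc u) zero    = does (Any.any? (u ≟_) ins)
dagArc (ins ◁ G) (suc u) (suc v) = dagArc G u v
dagArc (ins ◁ G) zero    _       = false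

toDigraph : Dag m → Digraph
toDigraph {m} G = record { n = m ; arc = dagArc G }

dagArc-descending : ∀ (G : Dag m) {u v} → dagArc G u v ≡ true → toℕ v < toℕ u
dagArc-descending (ins ◁ G) {suc u} {zero}  _  = z<s
dagArc-descending (ins ◁ G) {suc u} {suc v} uv = s≤s (dagArc-descending G uv)

toDigraph-acyclic : (G : Dag m) → Acyclic (toDigraph G)
toDigraph-acyclic G v p = <-irrefl refl (descending p)
  where
  descending : ∀ {u v} → Walk (toDigraph G) u v → toℕ v < toℕ u
  descending (one uv)    = dagArc-descending G uv
  descending (step uv p) = <-trans (descending p) (dagArc-descending G uv)

pathPower : ℕ → (m : ℕ) → Dag m
pathPower d zero    = []
pathPower d (suc m) = take d (allFin m) ◁ pathPower d m

Separated : Vec Bool k → Vec Bool k → Set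
Separated x y = ∃ λ a → Vec.lookup x a ≡ true × Vec.lookup y a ≡ false

separated? : (x y : Vec Bool k) → Dec (Separated x y)
separated? x y = any? λ a → (Vec.lookup x a ≟ᵇ true) ×-dec (Vec.lookup y a ≟ᵇ false)

subsets : ∀ k → List (Vec Bool k)
subsets zero    = [ [] ]
subsets (suc k) = cartesianProductWith _∷_ (false ∷ true ∷ []) (subsets k)

∈-subsets : (x : Vec Bool k) → x ∈ subsets k
∈-subsets []      = here refl
∈-subsets (b ∷ x) =
  ∈-cartesianProductWith⁺ _∷_ {xs = false ∷ true ∷ []} (∈-bools b) (∈-subsets x)
  where
  ∈-bools : ∀ b → b ∈ false ∷ true ∷ []
  ∈-bools false = here refl
  ∈-bools true  = there (here refl)

SeparatedFrom : Vec (Vec Bool k) m → List (Fin m) → Vec Bool k → Set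
SeparatedFrom σ ins x = All (λ u → Separated (Vec.lookup σ u) x) ins

separatedFrom? : ∀ (σ : Vec (Vec Bool k) m) ins x → Dec (SeparatedFrom σ ins x)
separatedFrom? σ ins x = All.all? (λ u → separated? (Vec.lookup σ u) x) ins

extensions : List (Fin m) → Vec (Vec Bool k) m → List (Vec (Vec Bool k) (suc m))
extensions {k = k} ins σ = map (_∷ σ) (filter (separatedFrom? σ ins) (subsets k))

∈-extensions⁺ : ∀ {ins : List (Fin m)} {σ : Vec (Vec Bool k) m} {x} →
                SeparatedFrom σ ins x → x ∷ σ ∈ extensions ins σ
∈-extensions⁺ {ins = ins} {σ} {x} fits =
  ∈-map⁺ (_∷ σ) (∈-filter⁺ (separatedFrom? σ ins) (∈-subsets x) fits)

labelings : ∀ k → Dag m → List (Vec (Vec Bool k) m)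
labelings k []        = [ [] ]
labelings k (ins ◁ G) = concatMap (extensions ins) (labelings k G)

labelings-complete : ∀ (G : Dag m) (L : Fin m → Vec Bool k) →
                     (∀ u v → dagArc G u v ≡ true → Separated (L u) (L v)) →
                     tabulate L ∈ labelings k G
labelings-complete []        L separated = here refl
labelings-complete (ins ◁ G) L separated =
  ∈-concatMap⁺ (extensions ins)
    (Any.map (λ { refl → ∈-extensions⁺ (All.tabulate fits) })
             (labelings-complete G (L ∘ suc) (λ u v → separated (suc u) (suc v))))
  where
  fits : ∀ {u} → u ∈ ins → Separated (Vec.lookup (tabulate (L ∘ suc)) u) (L zero)
  fits {u} u∈ = subst (λ x → Separated x (L zero)) (sym (lookup∘tabulate (L ∘ suc) u))
                      (separated (suc u) zero (dec-true (Any.any? (u ≟_) ins) u∈))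

labelings-empty⇒¬covered : ∀ (G : Dag m) → labelings k G ≡ [] → ¬ CoveredBy k (toDigraph G)
labelings-empty⇒¬covered {m = m} {k = k} G none (U , cut) =
  ¬Any[] (subst (tabulate L ∈_) none (labelings-complete G L separated))
  where
  L : Fin m → Vec Bool k
  L v = tabulate (λ a → U a v)
  separated : ∀ u v → dagArc G u v ≡ true → Separated (L u) (L v)
  separated u v uv with cut u v uv
  ... | a , ua , ¬va = a , trans (lookup∘tabulate _ a) ua , trans (lookup∘tabulate _ a) ¬va

degreeBound? : ∀ Δ⁻ Δ⁺ (D : Digraph) →
               Dec (∀ v → (+ indeg D v ℤ.≤ Δ⁻) ⊎ (+ outdeg D v ℤ.≤ Δ⁺))
degreeBound? Δ⁻ Δ⁺ D = all? λ v → (+ indeg D v ℤ.≤? Δ⁻) ⊎-dec (+ outdeg D v ℤ.≤? Δ⁺)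

dag⇒¬c≤ : ∀ {Δ⁻ Δ⁺} (G : Dag m) → True (degreeBound? Δ⁻ Δ⁺ (toDigraph G)) →
          labelings k G ≡ [] → ¬ c≤ Δ⁻ Δ⁺ k
dag⇒¬c≤ G bounded none c≤k =
  labelings-empty⇒¬covered G none (c≤k (toDigraph G) (toDigraph-acyclic G , toWitness bounded))

counterexample[2,2] : Dag 11
counterexample[2,2] = (# 0 ∷ [])
         ◁ (# 5 ∷ # 2 ∷ # 1 ∷ # 0 ∷ [])
         ◁ (# 4 ∷ # 1 ∷ # 0 ∷ [])
         ◁ (# 4 ∷ # 3 ∷ # 1 ∷ # 0 ∷ [])
         ◁ (# 1 ∷ # 0 ∷ [])
         ◁ (# 2 ∷ # 1 ∷ # 0 ∷ [])
         ◁ (# 2 ∷ # 1 ∷ # 0 ∷ [])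
         ◁ (# 1 ∷ # 0 ∷ [])
         ◁ (# 0 ∷ [])
         ◁ (# 0 ∷ [])
         ◁ []
         ◁ []

theorem2p3 : c≤ (+ 2) (+ 1) 3 × ¬ c≤ (+ 3) -[1+ 0 ] 3 × ¬ c≤ (+ 2) (+ 2) 3
theorem2p3 = c[2,1]≤3 , dag⇒¬c≤ (pathPower 3 11) _ refl , dag⇒¬c≤ counterexample[2,2] _ refl
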